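{- There exists a collection $\mathcal C$ of languages over a countably infinite universe that is uniformly generatable without noise (and hence non-uniformly generatable without noise), but is not non-uniformly generatable with noise level $1$ (and hence not uniformly generatable with noise level $1$).
   Context: A language is an infinite subset of the countably infinite universe $U$; a collection is a (possibly uncountable) set of languages. For $i \in \mathbb N=\{0,1,\dots\}$, an enumeration of a language $K$ with noise level $i$ is an infinite sequence $x_0, x_1, \dots$ of elements of $U$ without repetitions such that $K \subseteq \{x_j : j \in \mathbb N\}$ and $|\{x_j : j\in\mathbb N\} \setminus K| \le i$; "without noise" means noise level $0$. Write $S_t = \{x_0,\dots,x_t\}$. A generator algorithm is a function $G : U^* \to U$; at time $t$ it outputs $z_t = G(x_0,\dots,x_t)$. $G$ uniformly generates with noise level $i$ for $\mathcal C$ if there exists $t^\star$ such that for every $K\in\mathcal C$, every enumeration of $K$ with noise level at most $i$, and all $t\ge t^\star$, $z_t\in K\setminus S_t$. $G$ non-uniformly generates with noise level $i$ for $\mathcal C$ if for every $K\in\mathcal C$ there exists $t^\star$ such that for every enumeration of $K$ with noise level at most $i$ and all $t\ge t^\star$, $z_t\in K\setminus S_t$. A collection is generatable in a given sense if such an algorithm exists. -}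

module Defs where

open import Level using (0ℓ) renaming (suc to lsuc)
open import Data.Nat using (ℕ; _≤_)
open import Data.List using (List; map; upTo; length)
open import Data.List.Membership.Propositional using (_∈_)
open import Data.Product using (Σ; ∃; ∃-syntax; _×_)
open import Data.Sum using (_⊎_)
open import Relation.Binary.PropositionalEquality using (_≡_; _≢_)
open import Function.Definitions using (Injective)

U : Set
U = ℕ

Subset : Set₁
Subset = U → Set

Infinite : Subset → Set
Infinite K = ∀ n → ∃[ m ] (n ≤ m × K m)

Collection : Set₂
Collection = Subset → Set₁

IsCollectionOfLanguages : Collection → Set₁
IsCollectionOfLanguages C = ∀ K → C K → Infinite K

-- x is an enumeration of K with noise level (at most) i:
--  no repetitions, K ⊆ range x, and the elements of range x outside K
--  are contained in a list of length ≤ i (so |range x \ K| ≤ i).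
IsEnumeration : ℕ → Subset → (ℕ → U) → Set
IsEnumeration i K x =
  Injective _≡_ _≡_ x
  × (∀ a → K a → ∃[ j ] (x j ≡ a))
  × (∃[ L ] (length L ≤ i × (∀ j → K (x j) ⊎ x j ∈ L)))

Generator : Set
Generator = List U → U

prefix : (ℕ → U) → ℕ → List U
prefix x t = map x (upTo (Data.Nat.suc t))

GoodAt : Generator → Subset → (ℕ → U) → ℕ → Set
GoodAt G K x t = K (G (prefix x t)) × (∀ j → j ≤ t → x j ≢ G (prefix x t))

UniformlyGenerates : ℕ → Generator → Collection → Set₁
UniformlyGenerates i G C =
  ∃[ t⋆ ] (∀ K → C K → ∀ x → IsEnumeration i K x → ∀ t → t⋆ ≤ t → GoodAt G K x t)

NonUniformlyGenerates : ℕ → Generator → Collection → Set₁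
NonUniformlyGenerates i G C =
  ∀ K → C K → ∃[ t⋆ ] (∀ x → IsEnumeration i K x → ∀ t → t⋆ ≤ t → GoodAt G K x t)

UniformlyGeneratable : ℕ → Collection → Set₁
UniformlyGeneratable i C = ∃[ G ] UniformlyGenerates i G C

NonUniformlyGeneratable : ℕ → Collection → Set₁
NonUniformlyGeneratable i C = ∃[ G ] NonUniformlyGenerates i G C

{-# OPTIONS --safe #-}
-- Code ℕ as ℕ × ℕ (Cantor pairing, x ↦ (row x, col x)) and take the languages that are
-- unions of a nonempty set of rows. Without noise the first element x₀ lies in the target, hence
-- so does its whole row, and a column beyond every column seen so far gives a fresh element:
-- generation succeeds from time 0. With one noisy element, code rows once more as pairs (k, j).
-- Let z_k be the output of G on the head ⟪⟪k,0⟫,0⟫, …, ⟪⟪k,n_k⟫,0⟫, with n_k past the waiting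
-- time of the language L_k of rows (k, _); then z_k lies in a row (k, c_k). The language L_ω of
-- all rows except the rows (k, c_k) has, for every k, an enumeration starting with the same head
-- whose only noisy element is the one in row (k, c_k). For k the waiting time of L_ω this forces
-- z_k ∈ L_ω, which is absurd.
module Submission where

open import Defs
open import Data.Nat
open import Data.Nat.Properties
open import Data.Product using (Σ; ∃-syntax; _×_; _,_; proj₁; proj₂; uncurry)
open import Data.Product.Properties using (,-injective)
open import Data.Sum using (_⊎_; inj₁; inj₂)
open import Data.Maybe using (Maybe; just; nothing)
open import Data.Maybe.Properties using (just-injective; ≡-dec)
open import Data.List using (List; []; _∷_; map; upTo; length)
open import Data.List.Properties using (map-cong-local)
open import Data.List.Extrema.Nat using (max; xs≤max)
open import Data.List.Membership.Propositional using (_∈_)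
open import Data.List.Membership.Propositional.Properties using (∈-map⁺; ∈-upTo⁺)
open import Data.List.Relation.Unary.All using (lookup)
open import Data.List.Relation.Unary.All.Properties using (applyUpTo⁺₁)
open import Data.List.Relation.Unary.Any using (here)
open import Data.Empty using (⊥-elim)
open import Function using (_∘_; id)
open import Function.Definitions using (Injective)
open import Relation.Binary.PropositionalEquality
open import Relation.Nullary using (¬_; yes; no)
open import Relation.Nullary.Decidable using (_×-dec_)

tri : ℕ → ℕ
tri zero    = zero
tri (suc n) = suc n + tri n

⟪_,_⟫ : ℕ → ℕ → ℕ
⟪ a , b ⟫ = a + tri (a + b)

cantorSuc : ℕ × ℕ → ℕ × ℕ
cantorSuc (a , suc b) = suc a , b
cantorSuc (a , zero)  = zero , suc a

unpair : ℕ → ℕ × ℕ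
unpair zero    = zero , zero
unpair (suc x) = cantorSuc (unpair x)

row col : ℕ → ℕ
row = proj₁ ∘ unpair
col = proj₂ ∘ unpair

pair-suc-left : ∀ a b → ⟪ suc a , b ⟫ ≡ suc ⟪ a , suc b ⟫
pair-suc-left a b = cong (λ s → suc (a + tri s)) (sym (+-suc a b))

pair-zero-suc : ∀ b → ⟪ zero , suc b ⟫ ≡ suc ⟪ b , zero ⟫
pair-zero-suc b = cong (λ s → suc (b + tri s)) (sym (+-identityʳ b))

pair-cantorSuc : ∀ p → uncurry ⟪_,_⟫ (cantorSuc p) ≡ suc (uncurry ⟪_,_⟫ p)
pair-cantorSuc (a , suc b) = pair-suc-left a b
pair-cantorSuc (a , zero)  = pair-zero-suc a

pair-row-col : ∀ x → ⟪ row x , col x ⟫ ≡ x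
pair-row-col zero    = refl
pair-row-col (suc x) = trans (pair-cantorSuc (unpair x)) (cong suc (pair-row-col x))

unpair-pair′ : ∀ x a b → ⟪ a , b ⟫ ≡ x → unpair x ≡ (a , b)
unpair-pair′ zero    zero    zero    _  = refl
unpair-pair′ (suc x) (suc a) b       eq =
  cong cantorSuc (unpair-pair′ x a (suc b) (suc-injective (trans (sym (pair-suc-left a b)) eq)))
unpair-pair′ (suc x) zero    (suc b) eq =
  cong cantorSuc (unpair-pair′ x b zero (suc-injective (trans (sym (pair-zero-suc b)) eq)))

unpair-pair : ∀ a b → unpair ⟪ a , b ⟫ ≡ (a , b)
unpair-pair a b = unpair-pair′ ⟪ a , b ⟫ a b refl

row-pair : ∀ a b → row ⟪ a , b ⟫ ≡ a
row-pair a b = cong proj₁ (unpair-pair a b)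

col-pair : ∀ a b → col ⟪ a , b ⟫ ≡ b
col-pair a b = cong proj₂ (unpair-pair a b)

pair-injective : ∀ {a b c d} → ⟪ a , b ⟫ ≡ ⟪ c , d ⟫ → a ≡ c × b ≡ d
pair-injective {a} {b} {c} {d} eq =
  ,-injective (trans (sym (unpair-pair a b)) (trans (cong unpair eq) (unpair-pair c d)))

row-col-injective : ∀ {x y} → row x ≡ row y → col x ≡ col y → x ≡ y
row-col-injective {x} {y} r c =
  trans (sym (pair-row-col x)) (trans (cong₂ ⟪_,_⟫ r c) (pair-row-col y))

n≤tri : ∀ n → n ≤ tri n
n≤tri zero    = z≤n
n≤tri (suc n) = m≤m+n (suc n) (tri n)

col≤pair : ∀ a b → b ≤ ⟪ a , b ⟫
col≤pair a b = ≤-trans (m≤n+m b a) (≤-trans (n≤tri (a + b)) (m≤n+m _ a))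

punchIn : ℕ → ℕ → ℕ
punchIn zero    i       = suc i
punchIn (suc c) zero    = zero
punchIn (suc c) (suc i) = suc (punchIn c i)

punchIn-injective : ∀ c → Injective _≡_ _≡_ (punchIn c)
punchIn-injective zero    eq = suc-injective eq
punchIn-injective (suc c) {zero}  {zero}  _  = refl
punchIn-injective (suc c) {suc i} {suc j} eq = cong suc (punchIn-injective c (suc-injective eq))

punchInᵢ≢i : ∀ c i → punchIn c i ≢ c
punchInᵢ≢i (suc c) (suc i) eq = punchInᵢ≢i c i (suc-injective eq)

punchIn-surjective : ∀ c j → j ≢ c → ∃[ i ] punchIn c i ≡ j
punchIn-surjective zero    zero    j≢c = ⊥-elim (j≢c refl)
punchIn-surjective zero    (suc j) _   = j , refl
punchIn-surjective (suc c) zero    _   = zero , refl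
punchIn-surjective (suc c) (suc j) j≢c =
  let i , eq = punchIn-surjective c j (j≢c ∘ cong suc) in suc i , cong suc eq

punchInMaybe : Maybe ℕ → ℕ → ℕ
punchInMaybe nothing  = id
punchInMaybe (just c) = punchIn c

punchInMaybe-injective : ∀ h → Injective _≡_ _≡_ (punchInMaybe h)
punchInMaybe-injective nothing  eq = eq
punchInMaybe-injective (just c) eq = punchIn-injective c eq

punchInMaybe-avoids : ∀ h i → h ≢ just (punchInMaybe h i)
punchInMaybe-avoids (just c) i eq = punchInᵢ≢i c i (sym (just-injective eq))

punchInMaybe-surjective : ∀ h j → h ≢ just j → ∃[ i ] punchInMaybe h i ≡ j
punchInMaybe-surjective nothing  j _   = j , refl
punchInMaybe-surjective (just c) j h≢j = punchIn-surjective c j (h≢j ∘ cong just ∘ sym)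

record IsBijectionOnto (A : Subset) (f : ℕ → U) : Set where
  field
    injective : Injective _≡_ _≡_ f
    into      : ∀ n → A (f n)
    onto      : ∀ a → A a → ∃[ n ] f n ≡ a

RowLanguage : (ℕ → Set) → Subset
RowLanguage R x = R (row x)

liftRows : (ℕ → ℕ) → ℕ → ℕ
liftRows σ p = ⟪ σ (row p) , col p ⟫

liftRows-bijection : ∀ {R σ} → IsBijectionOnto R σ → IsBijectionOnto (RowLanguage R) (liftRows σ)
liftRows-bijection {R} {σ} σ-bij = record { injective = injective ; into = into ; onto = onto }
  where
  module σ = IsBijectionOnto σ-bij

  injective : Injective _≡_ _≡_ (liftRows σ)
  injective eq = let r , c = pair-injective eq in row-col-injective (σ.injective r) c

  into : ∀ p → R (row (liftRows σ p))
  into p = subst R (sym (row-pair _ _)) (σ.into (row p))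

  onto : ∀ x → R (row x) → ∃[ p ] liftRows σ p ≡ x
  onto x Rx with s , σs≡row ← σ.onto (row x) Rx =
    ⟪ s , col x ⟫ , (begin
      liftRows σ ⟪ s , col x ⟫
        ≡⟨ cong₂ (λ a b → ⟪ σ a , b ⟫) (row-pair s (col x)) (col-pair s (col x)) ⟩
      ⟪ σ s , col x ⟫
        ≡⟨ cong ⟪_, col x ⟫ σs≡row ⟩
      ⟪ row x , col x ⟫
        ≡⟨ pair-row-col x ⟩
      x ∎)
    where open ≡-Reasoning

AvoidsHoles : (ℕ → Maybe ℕ) → Subset
AvoidsHoles h x = h (row x) ≢ just (col x)

punchRows : (ℕ → Maybe ℕ) → ℕ → ℕ
punchRows h x = ⟪ row x , punchInMaybe (h (row x)) (col x) ⟫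

row-punchRows : ∀ h x → row (punchRows h x) ≡ row x
row-punchRows h x = row-pair _ _

punchRows-bijection : ∀ h → IsBijectionOnto (AvoidsHoles h) (punchRows h)
punchRows-bijection h = record { injective = injective ; into = into ; onto = onto }
  where
  injective : Injective _≡_ _≡_ (punchRows h)
  injective {x} {y} eq with r , c ← pair-injective eq = row-col-injective r
    (punchInMaybe-injective (h (row y)) (subst (λ a → punchInMaybe (h a) (col x) ≡ _) r c))

  into : ∀ x → AvoidsHoles h (punchRows h x)
  into x rewrite row-pair (row x) (punchInMaybe (h (row x)) (col x))
               | col-pair (row x) (punchInMaybe (h (row x)) (col x)) =
    punchInMaybe-avoids (h (row x)) (col x)

  onto : ∀ x → AvoidsHoles h x → ∃[ y ] punchRows h y ≡ x
  onto x avoids with i , eq ← punchInMaybe-surjective (h (row x)) (col x) avoids =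
    ⟪ row x , i ⟫ , (begin
      punchRows h ⟪ row x , i ⟫
        ≡⟨ cong₂ (λ a b → ⟪ a , punchInMaybe (h a) b ⟫) (row-pair (row x) i) (col-pair (row x) i) ⟩
      ⟪ row x , punchInMaybe (h (row x)) i ⟫
        ≡⟨ cong ⟪ row x ,_⟫ eq ⟩
      ⟪ row x , col x ⟫
        ≡⟨ pair-row-col x ⟩
      x ∎)
    where open ≡-Reasoning

punchedRowLanguage-bijection : ∀ {R σ} h → IsBijectionOnto R σ →
  IsBijectionOnto (λ x → RowLanguage R x × AvoidsHoles h x) (punchRows h ∘ liftRows σ)
punchedRowLanguage-bijection {R} {σ} h σ-bij = record { injective = injective ; into = into ; onto = onto }
  where
  module lift  = IsBijectionOnto (liftRows-bijection σ-bij)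
  module punch = IsBijectionOnto (punchRows-bijection h)

  injective : Injective _≡_ _≡_ (punchRows h ∘ liftRows σ)
  injective = lift.injective ∘ punch.injective

  into : ∀ p → RowLanguage R (punchRows h (liftRows σ p)) × AvoidsHoles h (punchRows h (liftRows σ p))
  into p = subst R (sym (row-punchRows h (liftRows σ p))) (lift.into p) , punch.into (liftRows σ p)

  onto : ∀ x → RowLanguage R x × AvoidsHoles h x → ∃[ p ] punchRows h (liftRows σ p) ≡ x
  onto x (Rx , avoids) with y , refl ← punch.onto x avoids
                      with p , refl ← lift.onto y (subst R (row-punchRows h y) Rx) =
    p , refl

splice : ℕ → (ℕ → U) → (ℕ → U) → ℕ → U
splice n q ρ j with j ≤? n
... | yes _ = q j
... | no  _ = ρ (j ∸ suc n)

splice-≤ : ∀ {n q ρ j} → j ≤ n → splice n q ρ j ≡ q j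
splice-≤ {n} {j = j} j≤n with j ≤? n
... | yes _   = refl
... | no  j≰n = ⊥-elim (j≰n j≤n)

splice-tail : ∀ n q ρ p → splice n q ρ (suc n + p) ≡ ρ p
splice-tail n q ρ p with suc n + p ≤? n
... | yes n<n = ⊥-elim (<-irrefl refl (≤-trans (m≤m+n (suc n) p) n<n))
... | no  _   = cong ρ (m+n∸m≡n (suc n) p)

prefix-splice : ∀ n q ρ → prefix (splice n q ρ) n ≡ map q (upTo (suc n))
prefix-splice n q ρ = map-cong-local (applyUpTo⁺₁ id (suc n) (splice-≤ ∘ ≤-pred))

splice-isEnumeration : ∀ {i K n q ρ} L →
  Injective _≡_ _≡_ q → Injective _≡_ _≡_ ρ → (∀ p j → j ≤ n → ρ p ≢ q j) →
  (∀ p → K (ρ p)) → (∀ x → K x → (∃[ j ] j ≤ n × q j ≡ x) ⊎ (∃[ p ] ρ p ≡ x)) →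
  length L ≤ i → (∀ j → j ≤ n → K (q j) ⊎ q j ∈ L) →
  IsEnumeration i K (splice n q ρ)
splice-isEnumeration {i} {K} {n} {q} {ρ} L q-inj ρ-inj disjoint ρ⊆K covers |L|≤i noise =
  injective , covered , L , |L|≤i , noisy
  where
  injective : Injective _≡_ _≡_ (splice n q ρ)
  injective {j} {j′} eq with j ≤? n | j′ ≤? n
  ... | yes _    | yes _     = q-inj eq
  ... | yes j≤n  | no  _     = ⊥-elim (disjoint _ j j≤n (sym eq))
  ... | no  _    | yes j′≤n  = ⊥-elim (disjoint _ j′ j′≤n eq)
  ... | no  j≰n  | no  j′≰n  = ∸-cancelʳ-≡ (≰⇒> j≰n) (≰⇒> j′≰n) (ρ-inj eq)

  covered : ∀ x → K x → ∃[ j ] splice n q ρ j ≡ x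
  covered x Kx with covers x Kx
  ... | inj₁ (j , j≤n , refl) = j , splice-≤ j≤n
  ... | inj₂ (p , refl)       = suc n + p , splice-tail n q ρ p

  noisy : ∀ j → K (splice n q ρ j) ⊎ splice n q ρ j ∈ L
  noisy j with j ≤? n
  ... | yes j≤n = noise j j≤n
  ... | no  _   = inj₁ (ρ⊆K _)

head : ℕ → ℕ → ℕ
head k j = ⟪ ⟪ k , j ⟫ , zero ⟫

head-injective : ∀ k → Injective _≡_ _≡_ (head k)
head-injective k {i} {j} eq = proj₂ (pair-injective {k} {i} {k} {j} ⟪k,i⟫≡⟪k,j⟫)
  where
  ⟪k,i⟫≡⟪k,j⟫ : ⟪ k , i ⟫ ≡ ⟪ k , j ⟫
  ⟪k,i⟫≡⟪k,j⟫ = proj₁ (pair-injective {⟪ k , i ⟫} {zero} {⟪ k , j ⟫} {zero} eq)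

headHoles : ℕ → ℕ → ℕ → Maybe ℕ
headHoles k n r with (row r ≟ k) ×-dec (col r ≤? n)
... | yes _ = just zero
... | no  _ = nothing

head-in-hole : ∀ {k n j} → j ≤ n → ¬ AvoidsHoles (headHoles k n) (head k j)
head-in-hole {k} {n} {j} j≤n avoids
  rewrite row-pair ⟪ k , j ⟫ zero | col-pair ⟪ k , j ⟫ zero
  with (row ⟪ k , j ⟫ ≟ k) ×-dec (col ⟪ k , j ⟫ ≤? n)
... | yes _   = avoids refl
... | no  ¬hr = ¬hr (row-pair k j , subst (_≤ n) (sym (col-pair k j)) j≤n)

hole-is-head : ∀ {k n} x → headHoles k n (row x) ≡ just (col x) → ∃[ j ] j ≤ n × head k j ≡ x
hole-is-head {k} {n} x hole with (row (row x) ≟ k) ×-dec (col (row x) ≤? n)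
hole-is-head {k} {n} x hole | yes (refl , j≤n) = col (row x) , j≤n , (begin
  ⟪ ⟪ row (row x) , col (row x) ⟫ , zero ⟫
    ≡⟨ cong₂ ⟪_,_⟫ (pair-row-col (row x)) (just-injective hole) ⟩
  ⟪ row x , col x ⟫
    ≡⟨ pair-row-col x ⟩
  x ∎)
  where open ≡-Reasoning

-- After the head comes the rest of the row language, row by row through σ, with column 0 of the
-- rows ⟪k, j⟫ (j ≤ n) punched out because the head already used it.
headEnumeration : ℕ → ℕ → (ℕ → U) → ℕ → U
headEnumeration k n σ = splice n (head k) (punchRows (headHoles k n) ∘ liftRows σ)

headEnumeration-isEnumeration : ∀ {i R σ} k n L → IsBijectionOnto R σ → length L ≤ i →
  (∀ j → j ≤ n → R ⟪ k , j ⟫ ⊎ head k j ∈ L) →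
  IsEnumeration i (RowLanguage R) (headEnumeration k n σ)
headEnumeration-isEnumeration {R = R} {σ} k n L σ-bij |L|≤i noise =
  splice-isEnumeration L (head-injective k) tail.injective disjoint (proj₁ ∘ tail.into) covers
    |L|≤i head-noise
  where
  module tail = IsBijectionOnto (punchedRowLanguage-bijection (headHoles k n) σ-bij)

  disjoint : ∀ p j → j ≤ n → punchRows (headHoles k n) (liftRows σ p) ≢ head k j
  disjoint p j j≤n eq = head-in-hole j≤n (subst (AvoidsHoles (headHoles k n)) eq (proj₂ (tail.into p)))

  covers : ∀ x → RowLanguage R x →
           (∃[ j ] j ≤ n × head k j ≡ x) ⊎ (∃[ p ] punchRows (headHoles k n) (liftRows σ p) ≡ x)
  covers x Rx with ≡-dec _≟_ (headHoles k n (row x)) (just (col x))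
  ... | yes hole   = inj₁ (hole-is-head x hole)
  ... | no  avoids = inj₂ (tail.onto x (Rx , avoids))

  head-noise : ∀ j → j ≤ n → RowLanguage R (head k j) ⊎ head k j ∈ L
  head-noise j j≤n with noise j j≤n
  ... | inj₁ Rkj = inj₁ (subst R (sym (row-pair ⟪ k , j ⟫ zero)) Rkj)
  ... | inj₂ ∈L  = inj₂ ∈L

RowClosed : Collection
RowClosed K = Σ (ℕ → Set) λ R → (∃[ r ] R r) × K ≡ RowLanguage R

RowClosed-languages : IsCollectionOfLanguages RowClosed
RowClosed-languages _ (R , (r , Rr) , refl) m =
  ⟪ r , m ⟫ , col≤pair r m , subst R (sym (row-pair r m)) Rr

rowLanguage-rowClosed : ∀ {R σ} → IsBijectionOnto R σ → RowClosed (RowLanguage R)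
rowLanguage-rowClosed {R} {σ} σ-bij = R , (σ zero , IsBijectionOnto.into σ-bij zero) , refl

maxCol : List U → ℕ
maxCol xs = max zero (map col xs)

col≤maxCol : ∀ {y xs} → y ∈ xs → col y ≤ maxCol xs
col≤maxCol {xs = xs} y∈xs = lookup (xs≤max zero (map col xs)) (∈-map⁺ col y∈xs)

freshInFirstRow : Generator
freshInFirstRow []       = zero
freshInFirstRow (x ∷ xs) = ⟪ row x , suc (maxCol (x ∷ xs)) ⟫

noiseless : ∀ {K x} → IsEnumeration 0 K x → ∀ j → K (x j)
noiseless (_ , _ , [] , _ , inK) j with inK j
... | inj₁ Kxj = Kxj

freshInFirstRow-uniform : UniformlyGenerates 0 freshInFirstRow RowClosed
freshInFirstRow-uniform = zero , good
  where
  good : ∀ K → RowClosed K → ∀ x → IsEnumeration 0 K x →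
         ∀ t → zero ≤ t → GoodAt freshInFirstRow K x t
  good _ (R , _ , refl) x enum t _ = inK , fresh
    where
    m = maxCol (prefix x t)
    inK : R (row ⟪ row (x zero) , suc m ⟫)
    inK = subst R (sym (row-pair _ _)) (noiseless enum zero)
    fresh : ∀ j → j ≤ t → x j ≢ ⟪ row (x zero) , suc m ⟫
    fresh j j≤t eq = 1+n≰n (subst (_≤ m) col≡suc-m col≤m)
      where
      col≤m : col (x j) ≤ m
      col≤m = col≤maxCol (∈-map⁺ x (∈-upTo⁺ (s≤s j≤t)))
      col≡suc-m : col (x j) ≡ suc m
      col≡suc-m = trans (cong col eq) (col-pair (row (x zero)) (suc m))

uniform⇒nonUniform : ∀ {i C} → UniformlyGeneratable i C → NonUniformlyGeneratable i C
uniform⇒nonUniform (G , t⋆ , gen) = G , λ K CK → t⋆ , gen K CK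

headOutput : Generator → ℕ → ℕ → U
headOutput G k n = G (map (head k) (upTo (suc n)))

headOutput-∈ : ∀ {i G R σ} (gen : NonUniformlyGenerates i G RowClosed)
  (σ-bij : IsBijectionOnto R σ) → ∀ k n L → length L ≤ i →
  (∀ j → j ≤ n → R ⟪ k , j ⟫ ⊎ head k j ∈ L) →
  proj₁ (gen (RowLanguage R) (rowLanguage-rowClosed σ-bij)) ≤ n → RowLanguage R (headOutput G k n)
headOutput-∈ {G = G} {R} {σ} gen σ-bij k n L |L|≤i noise t⋆≤n =
  subst (RowLanguage R ∘ G) (prefix-splice n (head k) _) (proj₁ good)
  where
  good = proj₂ (gen (RowLanguage R) (rowLanguage-rowClosed σ-bij)) (headEnumeration k n σ)
           (headEnumeration-isEnumeration k n L σ-bij |L|≤i noise) n t⋆≤n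

row-bijection : ∀ k → IsBijectionOnto (λ r → row r ≡ k) ⟪ k ,_⟫
row-bijection k = record
  { injective = λ {i} {j} eq → proj₂ (pair-injective {k} {i} {k} {j} eq)
  ; into      = row-pair k
  ; onto      = λ r row≡k → col r , trans (cong ⟪_, col r ⟫ (sym row≡k)) (pair-row-col r)
  }

¬nonUniform1 : ¬ NonUniformlyGeneratable 1 RowClosed
¬nonUniform1 (G , gen) = inLω (cong (just ∘ c) inLk)
  where
  t : ℕ → ℕ
  t k = proj₁ (gen _ (rowLanguage-rowClosed (row-bijection k)))

  z : ℕ → U
  z k = headOutput G k (t k + k)

  c : ℕ → ℕ
  c k = col (row (z k))

  -- the head length t k + k then exceeds the waiting times of both L_k and L_ω
  k : ℕ
  k = proj₁ (gen _ (rowLanguage-rowClosed (punchRows-bijection (just ∘ c))))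

  inLk : row (row (z k)) ≡ k
  inLk = headOutput-∈ {G = G} gen (row-bijection k) k (t k + k) [] z≤n
           (λ j _ → inj₁ (row-pair k j)) (m≤m+n (t k) k)

  noise : ∀ j → j ≤ t k + k →
          AvoidsHoles (just ∘ c) ⟪ k , j ⟫ ⊎ head k j ∈ head k (c k) ∷ []
  noise j _ with j ≟ c k
  ... | yes refl = inj₂ (here refl)
  ... | no  j≢ck = inj₁ λ eq →
    j≢ck (sym (trans (cong c (sym (row-pair k j))) (trans (just-injective eq) (col-pair k j))))

  inLω : AvoidsHoles (just ∘ c) (row (z k))
  inLω = headOutput-∈ {G = G} gen (punchRows-bijection (just ∘ c)) k (t k + k) (head k (c k) ∷ [])
           ≤-refl noise (m≤n+m k (t k))

mainTheorem9 : ∃[ C ] (IsCollectionOfLanguages C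
                × UniformlyGeneratable 0 C
                × NonUniformlyGeneratable 0 C
                × ¬ NonUniformlyGeneratable 1 C
                × ¬ UniformlyGeneratable 1 C)
mainTheorem9 = RowClosed , RowClosed-languages
             , uniform0 , uniform⇒nonUniform uniform0
             , ¬nonUniform1 , ¬nonUniform1 ∘ uniform⇒nonUniform
  where
  uniform0 = freshInFirstRow , freshInFirstRow-uniform
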